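{- Let $k\ge1$. There is a bound $N_k$ such that for every odd integer $n\ge N_k$ with $s(n)=s(n^2)=k$, the binary expansion of $n$ can be written as a concatenation $$(n)_2=x_m\,0^{\ell_m}\,x_{m-1}\,0^{\ell_{m-1}}\cdots x_1\,0^{\ell_1}\,x_0,$$ where $1\le m<k$, each $x_i$ ($0\le i\le m$) is the binary expansion of an odd positive integer (a binary word beginning and ending with $1$), $0^{\ell}$ denotes a block of $\ell$ zero bits, $\ell_1,\dots,\ell_m$ are natural numbers, and $$\min_{1\le i\le m}\ell_i>2\max_{0\le i\le m}|x_i|+k^2,$$ where $|x_i|$ denotes the length (number of bits) of the word $x_i$.
   Context: $s(n)$ is the sum of binary digits of $n$; $(n)_2$ denotes the binary expansion of $n$, written from most significant to least significant bit. -}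

module Defs where

open import Data.Nat using (ℕ; zero; suc; _+_; _*_; _/_; _%_; _≡ᵇ_; _<_)
open import Data.Bool using (Bool; true; false; if_then_else_)
open import Data.List using (List; []; _∷_; _++_; [_]; replicate; length; reverse)
open import Data.Fin using (Fin; zero; suc; fromℕ; inject₁)
open import Function using (_∘_)
open import Relation.Binary.PropositionalEquality using (_≡_)

-- Least-significant-bit-first binary digits, with fuel (fuel n suffices for n).
bitsLSB : ℕ → ℕ → List Bool
bitsLSB zero    _ = []
bitsLSB (suc f) zero = []
bitsLSB (suc f) n@(suc _) = (n % 2 ≡ᵇ 1) ∷ bitsLSB f (n / 2)

-- (n)_2 : binary expansion, most significant bit first; (0)_2 is the empty word.
bin : ℕ → List Bool
bin n = reverse (bitsLSB n n)

bitVal : Bool → ℕ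
bitVal true  = 1
bitVal false = 0

sumBits : List Bool → ℕ
sumBits [] = 0
sumBits (b ∷ bs) = bitVal b + sumBits bs

s : ℕ → ℕ
s n = sumBits (bin n)

Odd : ℕ → Set
Odd n = n % 2 ≡ 1

-- The word  x_m 0^{ℓ_m} x_{m-1} 0^{ℓ_{m-1}} ... x_1 0^{ℓ_1} x_0,
-- where x i is the odd integer whose binary expansion is the word x_i
-- (i = 0..m), and ℓ j = ℓ_{j+1} (j = 0..m-1).
layout : (m : ℕ) → (Fin (suc m) → ℕ) → (Fin m → ℕ) → List Bool
layout zero    x ℓ = bin (x zero)
layout (suc m) x ℓ =
  bin (x (fromℕ (suc m))) ++ (replicate (ℓ (fromℕ m)) false ++ layout m (x ∘ inject₁) (ℓ ∘ inject₁))

-- Write (n)_2 = 1 0^{g_1} 1 0^{g_2} ⋯ 0^{g_{k-1}} 1 and fix thresholds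
-- t_0 = 0 < t_1 < ⋯ < t_{k-1} with t_{j+1} > 2 k (t_j + 1) + k².  The k − 1 runs g_i
-- cannot meet all k intervals [t_j, t_{j+1}), so some interval contains none of
-- them.  Cutting (n)_2 at the runs of length ≥ t_j leaves blocks made of runs
-- shorter than t_j, hence of at most k (t_j + 1) bits, separated by runs of length
-- ≥ t_{j+1}.  If there were no cut at all, n would have fewer than k (t_{k-1} + 1)
-- bits, which is excluded by taking N_k = 2^{k (t_{k-1} + 1)}.
module Submission where

open import Defs
open import Data.Nat using (ℕ; zero; suc; _+_; _*_; _≤_; _<_; _≤′_; ≤′-refl; ≤′-step; _^_; _/_; _%_; _≡ᵇ_; z≤n; s≤s; _≤?_)
open import Data.Nat.Properties
open import Data.Nat.DivMod
open import Data.Nat.Divisibility using (n∣m*n)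
open import Data.Bool using (Bool; true; false)
open import Data.List using (List; []; _∷_; _++_; [_]; _∷ʳ_; replicate; length; reverse)
open import Data.List.Properties
  using (length-++; length-replicate; unfold-reverse; reverse-++; length-reverse; ++-assoc; ++-identityʳ; reverse-involutive)
open import Data.List.Relation.Unary.All as All using (All; []; _∷_)
open import Data.Fin using (Fin; zero; suc; fromℕ; inject₁)
open import Data.Product using (Σ; _×_; _,_; proj₁; proj₂; ∃; ∃₂; map₂)
open import Data.Sum using (_⊎_; inj₁; inj₂)
open import Data.Empty using (⊥-elim)
open import Function using (_∘_)
open import Relation.Binary.PropositionalEquality using (_≡_; refl; sym; trans; cong; cong₂; subst; module ≡-Reasoning)
open import Relation.Nullary using (yes; no)

valueLSB : List Bool → ℕ
valueLSB []      = 0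
valueLSB (b ∷ v) = bitVal b + valueLSB v * 2

bitVal<2 : ∀ b → bitVal b < 2
bitVal<2 true  = s≤s (s≤s z≤n)
bitVal<2 false = s≤s z≤n

valueLSB-%2 : ∀ b v → valueLSB (b ∷ v) % 2 ≡ bitVal b
valueLSB-%2 b v = trans ([m+kn]%n≡m%n (bitVal b) (valueLSB v) 2) (m<n⇒m%n≡m (bitVal<2 b))

valueLSB-/2 : ∀ b v → valueLSB (b ∷ v) / 2 ≡ valueLSB v
valueLSB-/2 b v = trans (+-distrib-/-∣ʳ (bitVal b) (n∣m*n (valueLSB v)))
                        (cong₂ _+_ (m<n⇒m/n≡0 (bitVal<2 b)) (m*n/n≡m (valueLSB v) 2))

bitVal-≡ᵇ1 : ∀ b → (bitVal b ≡ᵇ 1) ≡ b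
bitVal-≡ᵇ1 true  = refl
bitVal-≡ᵇ1 false = refl

bitsLSB-0 : ∀ f → bitsLSB f 0 ≡ []
bitsLSB-0 zero    = refl
bitsLSB-0 (suc f) = refl

bitsLSB-suc : ∀ f n → 1 ≤ n → bitsLSB (suc f) n ≡ (n % 2 ≡ᵇ 1) ∷ bitsLSB f (n / 2)
bitsLSB-suc f (suc n) _ = refl

length≤valueLSB : ∀ u → length (u ∷ʳ true) ≤ valueLSB (u ∷ʳ true)
length≤valueLSB []      = s≤s z≤n
length≤valueLSB (b ∷ u) = begin
  suc (length (u ∷ʳ true))  ≤⟨ +-mono-≤ (≤-trans (1≤length u) IH) IH ⟩
  y + y                     ≡⟨ cong (y +_) (sym (*-identityʳ y)) ⟩
  y + y * 1                 ≡⟨ sym (*-suc y 1) ⟩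
  y * 2                     ≤⟨ m≤n+m (y * 2) (bitVal b) ⟩
  bitVal b + y * 2          ∎
  where
  open ≤-Reasoning
  y  = valueLSB (u ∷ʳ true)
  IH = length≤valueLSB u
  1≤length : ∀ u → 1 ≤ length (u ∷ʳ true)
  1≤length []      = s≤s z≤n
  1≤length (_ ∷ _) = s≤s z≤n

bitsLSB-valueLSB : ∀ u f → length (u ∷ʳ true) ≤ f → bitsLSB f (valueLSB (u ∷ʳ true)) ≡ u ∷ʳ true
bitsLSB-valueLSB []      (suc f) _        = cong (true ∷_) (bitsLSB-0 f)
bitsLSB-valueLSB (b ∷ u) (suc f) (s≤s le) = begin
  bitsLSB (suc f) n                                 ≡⟨ bitsLSB-suc f n (≤-trans (s≤s z≤n) (length≤valueLSB (b ∷ u))) ⟩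
  (n % 2 ≡ᵇ 1) ∷ bitsLSB f (n / 2)                  ≡⟨ cong₂ _∷_ (trans (cong (_≡ᵇ 1) (valueLSB-%2 b (u ∷ʳ true))) (bitVal-≡ᵇ1 b))
                                                                 (cong (bitsLSB f) (valueLSB-/2 b (u ∷ʳ true))) ⟩
  b ∷ bitsLSB f (valueLSB (u ∷ʳ true))              ≡⟨ cong (b ∷_) (bitsLSB-valueLSB u f le) ⟩
  b ∷ u ∷ʳ true                                     ∎
  where
  open ≡-Reasoning
  n = valueLSB (b ∷ u ∷ʳ true)

half<self : ∀ m → suc m / 2 < suc m
half<self m = m/n<m (suc m) 2 (s≤s (s≤s z≤n))

bitsLSB-last : ∀ f n → 1 ≤ n → n ≤ f → ∃ λ u → bitsLSB f n ≡ u ∷ʳ true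
bitsLSB-last (suc f) 1             _ _        = [] , cong (true ∷_) (bitsLSB-0 f)
bitsLSB-last (suc f) n@(suc (suc m)) _ (s≤s le)
  with bitsLSB-last f (n / 2) (m≥n⇒m/n>0 {n} {2} (s≤s (s≤s z≤n))) (≤-trans (<⇒≤pred (half<self (suc m))) le)
... | u , eq = (n % 2 ≡ᵇ 1) ∷ u , cong (_ ∷_) eq

<-2^length-bitsLSB : ∀ f n → n ≤ f → n < 2 ^ length (bitsLSB f n)
<-2^length-bitsLSB zero    zero    _        = s≤s z≤n
<-2^length-bitsLSB (suc f) zero    _        = s≤s z≤n
<-2^length-bitsLSB (suc f) n@(suc m) (s≤s le) = begin-strict
  n                    ≡⟨ m≡m%n+[m/n]*n n 2 ⟩
  n % 2 + (n / 2) * 2  ≤⟨ +-monoˡ-≤ ((n / 2) * 2) (<⇒≤pred (m%n<n n 2)) ⟩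
  1 + (n / 2) * 2      <⟨ n<1+n _ ⟩
  suc (n / 2) * 2      ≤⟨ *-monoˡ-≤ 2 (<-2^length-bitsLSB f (n / 2) (≤-trans (<⇒≤pred (half<self m)) le)) ⟩
  2 ^ L * 2            ≡⟨ *-comm (2 ^ L) 2 ⟩
  2 ^ suc L            ∎
  where
  open ≤-Reasoning
  L = length (bitsLSB f (n / 2))

-- Words 1 0^{g_1} 1 ⋯ 0^{g_r} 1 given by their runs of zeros

word : List ℕ → List Bool
word []       = [ true ]
word (g ∷ gs) = true ∷ (replicate g false ++ word gs)

sumBits-zeros : ∀ g w → sumBits (replicate g false ++ w) ≡ sumBits w
sumBits-zeros zero    w = refl
sumBits-zeros (suc g) w = sumBits-zeros g w

sumBits-word : ∀ gs → sumBits (word gs) ≡ suc (length gs)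
sumBits-word []       = refl
sumBits-word (g ∷ gs) = cong suc (trans (sumBits-zeros g (word gs)) (sumBits-word gs))

length-word≤ : ∀ T gs → All (_< T) gs → length (word gs) ≤ suc (length gs * suc T)
length-word≤ T []       _            = s≤s z≤n
length-word≤ T (g ∷ gs) (g<T ∷ gs<T) = s≤s (begin
  length (replicate g false ++ word gs)  ≡⟨ length-++ (replicate g false) ⟩
  length (replicate g false) + length (word gs)
                                         ≡⟨ cong (_+ length (word gs)) (length-replicate g) ⟩
  g + length (word gs)                   ≤⟨ +-mono-≤ (<⇒≤ g<T) (length-word≤ T gs gs<T) ⟩
  T + suc (length gs * suc T)            ≡⟨ +-suc T _ ⟩
  suc T + length gs * suc T              ∎)
  where open ≤-Reasoning

word-last : ∀ gs → ∃ λ u → word gs ≡ u ∷ʳ true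
word-last []       = [] , refl
word-last (g ∷ gs) with word-last gs
... | u , eq = true ∷ replicate g false ++ u ,
  cong (true ∷_) (trans (cong (replicate g false ++_) eq) (sym (++-assoc (replicate g false) u _)))

zeros-word : ∀ xs → ∃₂ λ g gs → xs ∷ʳ true ≡ replicate g false ++ word gs
zeros-word []           = 0 , [] , refl
zeros-word (false ∷ xs) with zeros-word xs
... | g , gs , eq = suc g , gs , cong (false ∷_) eq
zeros-word (true ∷ xs)  with zeros-word xs
... | g , gs , eq = 0 , g ∷ gs , cong (true ∷_) eq

wordValue : List ℕ → ℕ
wordValue gs = valueLSB (reverse (word gs))

word-head : ∀ gs → ∃ λ w → word gs ≡ true ∷ w
word-head []       = [] , refl
word-head (g ∷ gs) = replicate g false ++ word gs , refl

bin-wordValue : ∀ gs → bin (wordValue gs) ≡ word gs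
bin-wordValue gs with word-head gs
... | w , eq = begin
  reverse (bitsLSB n n)                       ≡⟨ cong (λ v → reverse (bitsLSB (valueLSB v) (valueLSB v))) rev≡ ⟩
  reverse (bitsLSB (valueLSB v) (valueLSB v)) ≡⟨ cong reverse (bitsLSB-valueLSB (reverse w) _ (length≤valueLSB (reverse w))) ⟩
  reverse v                                   ≡⟨ cong reverse (sym rev≡) ⟩
  reverse (reverse (word gs))                 ≡⟨ reverse-involutive (word gs) ⟩
  word gs                                     ∎
  where
  open ≡-Reasoning
  n = wordValue gs
  v = reverse w ∷ʳ true
  rev≡ : reverse (word gs) ≡ v
  rev≡ = trans (cong reverse eq) (unfold-reverse true w)

wordValue-odd : ∀ gs → 1 ≤ wordValue gs × Odd (wordValue gs)
wordValue-odd gs with word-last gs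
... | u , eq rewrite eq | reverse-++ u [ true ] =
  s≤s z≤n , [m+kn]%n≡m%n 1 (valueLSB (reverse u)) 2

bin-odd : ∀ n → Odd n → ∃ λ gs → bin n ≡ word gs
bin-odd (suc m) odd with bitsLSB-last (suc m) (suc m) (s≤s z≤n) ≤-refl
... | []     , eq = [] , cong reverse eq
... | t ∷ u , eq with zeros-word (reverse u)
...   | g , gs , zeros≡ = g ∷ gs , (begin
  reverse (bitsLSB n n)              ≡⟨ cong reverse eq ⟩
  reverse ((t ∷ u) ∷ʳ true)          ≡⟨ reverse-++ (t ∷ u) [ true ] ⟩
  true ∷ reverse (t ∷ u)             ≡⟨ cong (true ∷_) (unfold-reverse t u) ⟩
  true ∷ (reverse u ∷ʳ t)            ≡⟨ cong (λ b → true ∷ (reverse u ∷ʳ b)) t≡true ⟩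
  true ∷ (reverse u ∷ʳ true)         ≡⟨ cong (true ∷_) zeros≡ ⟩
  word (g ∷ gs)                      ∎)
  where
  open ≡-Reasoning
  n = suc m
  head-or-false : List Bool → Bool
  head-or-false []      = false
  head-or-false (b ∷ _) = b
  t≡true : t ≡ true
  t≡true = trans (sym (cong head-or-false eq)) (cong (_≡ᵇ 1) odd)

-- An interval avoided by all runs

Outside : ℕ → ℕ → ℕ → Set
Outside T U g = g < T ⊎ U ≤ g

countAtLeast : ℕ → List ℕ → ℕ
countAtLeast T []       = 0
countAtLeast T (g ∷ gs) with T ≤? g
... | yes _ = suc (countAtLeast T gs)
... | no _  = countAtLeast T gs

countAtLeast≤length : ∀ T gs → countAtLeast T gs ≤ length gs
countAtLeast≤length T []       = z≤n
countAtLeast≤length T (g ∷ gs) with T ≤? g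
... | yes _ = s≤s (countAtLeast≤length T gs)
... | no _  = m≤n⇒m≤1+n (countAtLeast≤length T gs)

countAtLeast-antitone : ∀ {T U} → T ≤ U → ∀ gs → countAtLeast U gs ≤ countAtLeast T gs
countAtLeast-antitone T≤U [] = z≤n
countAtLeast-antitone {T} {U} T≤U (g ∷ gs) with U ≤? g | T ≤? g
... | yes _   | yes _   = s≤s (countAtLeast-antitone T≤U gs)
... | yes U≤g | no T≰g  = ⊥-elim (T≰g (≤-trans T≤U U≤g))
... | no _    | yes _   = m≤n⇒m≤1+n (countAtLeast-antitone T≤U gs)
... | no _    | no _    = countAtLeast-antitone T≤U gs

countAtLeast-drops : ∀ {T U} → T ≤ U → ∀ gs →
  All (Outside T U) gs ⊎ countAtLeast U gs < countAtLeast T gs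
countAtLeast-drops T≤U [] = inj₁ []
countAtLeast-drops {T} {U} T≤U (g ∷ gs) with U ≤? g | T ≤? g | countAtLeast-drops T≤U gs
... | yes U≤g | yes _   | inj₁ out = inj₁ (inj₂ U≤g ∷ out)
... | yes _   | yes _   | inj₂ lt  = inj₂ (s≤s lt)
... | yes U≤g | no T≰g  | _        = ⊥-elim (T≰g (≤-trans T≤U U≤g))
... | no _    | yes _   | _        = inj₂ (s≤s (countAtLeast-antitone T≤U gs))
... | no _    | no T≰g  | inj₁ out = inj₁ (inj₁ (≰⇒> T≰g) ∷ out)
... | no _    | no _    | inj₂ lt  = inj₂ lt

-- Each interval [t j, t (suc j)) met by the list lowers the count of entries ≥ t j.
avoided-interval : (t : ℕ → ℕ) → (∀ j → t j ≤ t (suc j)) → ∀ c gs → countAtLeast (t 0) gs ≤ c →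
  ∃ λ j → j ≤ c × All (Outside (t j) (t (suc j))) gs
avoided-interval t t↑ c gs count≤c with countAtLeast-drops (t↑ 0) gs
... | inj₁ out = 0 , z≤n , out
avoided-interval t t↑ zero    gs count≤c | inj₂ lt = ⊥-elim (<⇒≱ lt (≤-trans count≤c z≤n))
avoided-interval t t↑ (suc c) gs count≤c | inj₂ lt
  with avoided-interval (t ∘ suc) (t↑ ∘ suc) c gs (≤-pred (≤-trans lt count≤c))
... | j , j≤c , out = suc j , s≤s j≤c , out

-- Cutting a word at its long runs

-- Pairs (length of a separating run of zeros, runs of the block that follows).
render : List (ℕ × List ℕ) → List Bool
render []             = []
render ((G , b) ∷ r) = replicate G false ++ (word b ++ render r)

SmallBlock : ℕ → ℕ → List ℕ → Set
SmallBlock T K b = All (_< T) b × length b ≤ K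

record Cut (T : ℕ) (P : ℕ → Set) (gs : List ℕ) : Set where
  field
    top         : List ℕ
    rest        : List (ℕ × List ℕ)
    word≡       : word gs ≡ word top ++ render rest
    top-small   : SmallBlock T (length gs) top
    rest-small  : All (SmallBlock T (length gs) ∘ proj₂) rest
    rest-long   : All (λ p → T ≤ proj₁ p × P (proj₁ p)) rest
    length-rest : length rest ≤ length gs

cut : ∀ T P gs → All P gs → Cut T P gs
cut T P [] _ = record
  { top = [] ; rest = [] ; word≡ = refl ; top-small = [] , z≤n
  ; rest-small = [] ; rest-long = [] ; length-rest = z≤n }
cut T P (g ∷ gs) (pg ∷ pgs) with cut T P gs pgs | T ≤? g
... | c | yes T≤g = record
  { top = [] ; rest = (g , top) ∷ rest
  ; word≡ = cong (λ w → true ∷ (replicate g false ++ w)) word≡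
  ; top-small = [] , z≤n
  ; rest-small = map₂ m≤n⇒m≤1+n top-small ∷ All.map (map₂ m≤n⇒m≤1+n) rest-small
  ; rest-long = (T≤g , pg) ∷ rest-long
  ; length-rest = s≤s length-rest }
  where open Cut c
... | c | no T≰g = record
  { top = g ∷ top ; rest = rest
  ; word≡ = cong (true ∷_) (trans (cong (replicate g false ++_) word≡) (sym (++-assoc (replicate g false) (word top) _)))
  ; top-small = ≰⇒> T≰g ∷ proj₁ top-small , s≤s (proj₂ top-small)
  ; rest-small = All.map (map₂ m≤n⇒m≤1+n) rest-small
  ; rest-long = rest-long
  ; length-rest = m≤n⇒m≤1+n length-rest }
  where open Cut c

snoc : ∀ {n} {A : Set} → (Fin n → A) → A → Fin (suc n) → A
snoc {zero}  f a zero    = a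
snoc {suc n} f a zero    = f zero
snoc {suc n} f a (suc i) = snoc (f ∘ suc) a i

snoc-inject₁ : ∀ {n} {A : Set} (f : Fin n → A) a i → snoc f a (inject₁ i) ≡ f i
snoc-inject₁ {suc n} f a zero    = refl
snoc-inject₁ {suc n} f a (suc i) = snoc-inject₁ (f ∘ suc) a i

snoc-fromℕ : ∀ n {A : Set} (f : Fin n → A) a → snoc f a (fromℕ n) ≡ a
snoc-fromℕ zero    f a = refl
snoc-fromℕ (suc n) f a = snoc-fromℕ n (f ∘ suc) a

snoc-all : ∀ {n} {A : Set} (P : A → Set) (f : Fin n → A) a → (∀ i → P (f i)) → P a → ∀ i → P (snoc f a i)
snoc-all {zero}  P f a Pf Pa zero    = Pa
snoc-all {suc n} P f a Pf Pa zero    = Pf zero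
snoc-all {suc n} P f a Pf Pa (suc i) = snoc-all P (f ∘ suc) a (Pf ∘ suc) Pa i

-- Index i of a layout counts from the least significant end, hence the snoc.
blocks : List ℕ → (r : List (ℕ × List ℕ)) → Fin (suc (length r)) → ℕ
blocks top []             = λ _ → wordValue top
blocks top ((G , b) ∷ r) = snoc (blocks b r) (wordValue top)

separators : (r : List (ℕ × List ℕ)) → Fin (length r) → ℕ
separators []             ()
separators ((G , b) ∷ r) = snoc (separators r) G

layout-cong : ∀ m {x y : Fin (suc m) → ℕ} {ℓ ℓ′ : Fin m → ℕ} →
  (∀ i → x i ≡ y i) → (∀ j → ℓ j ≡ ℓ′ j) → layout m x ℓ ≡ layout m y ℓ′
layout-cong zero    x≡y ℓ≡ℓ′ = cong bin (x≡y zero)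
layout-cong (suc m) x≡y ℓ≡ℓ′ =
  cong₂ _++_ (cong bin (x≡y _))
    (cong₂ _++_ (cong (λ G → replicate G false) (ℓ≡ℓ′ _)) (layout-cong m (x≡y ∘ inject₁) (ℓ≡ℓ′ ∘ inject₁)))

layout-blocks : ∀ top r → layout (length r) (blocks top r) (separators r) ≡ word top ++ render r
layout-blocks top [] = trans (bin-wordValue top) (sym (++-identityʳ (word top)))
layout-blocks top ((G , b) ∷ r) =
  cong₂ _++_ (trans (cong bin (snoc-fromℕ (suc (length r)) (blocks b r) (wordValue top))) (bin-wordValue top))
    (cong₂ _++_ (cong (λ G → replicate G false) (snoc-fromℕ _ (separators r) G))
      (trans (layout-cong _ (snoc-inject₁ (blocks b r) (wordValue top)) (snoc-inject₁ (separators r) G))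
             (layout-blocks b r)))

blocks-all : ∀ (P : List ℕ → Set) top r → P top → All (P ∘ proj₂) r →
  ∀ i → ∃ λ b → P b × blocks top r i ≡ wordValue b
blocks-all P top []             Ptop _          _ = top , Ptop , refl
blocks-all P top ((G , b) ∷ r) Ptop (Pb ∷ Pr) =
  snoc-all (λ x → ∃ λ b → P b × x ≡ wordValue b) (blocks b r) (wordValue top) (blocks-all P b r Pb Pr) (top , Ptop , refl)

separators-all : ∀ (P : ℕ → Set) r → All (P ∘ proj₁) r → ∀ j → P (separators r j)
separators-all P []             _          ()
separators-all P ((G , b) ∷ r) (PG ∷ Pr) = snoc-all P (separators r) G (separators-all P r Pr) PG

Decomposition : ℕ → ℕ → Set
Decomposition k n =
  Σ ℕ λ m → Σ (Fin (suc m) → ℕ) λ x → Σ (Fin m → ℕ) λ ℓ →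
    (1 ≤ m) × (m < k) ×
    ((i : Fin (suc m)) → 1 ≤ x i × Odd (x i)) ×
    (bin n ≡ layout m x ℓ) ×
    ((j : Fin m) → (i : Fin (suc m)) → 2 * length (bin (x i)) + k * k < ℓ j)

length-word-small : ∀ {T K} b → SmallBlock T K b → length (word b) ≤ suc K * suc T
length-word-small {T} {K} b (b<T , length≤K) = begin
  length (word b)          ≤⟨ length-word≤ T b b<T ⟩
  suc (length b * suc T)   ≤⟨ s≤s (*-monoˡ-≤ (suc T) length≤K) ⟩
  suc (K * suc T)          ≤⟨ +-monoˡ-≤ (K * suc T) (s≤s z≤n) ⟩
  suc K * suc T            ∎
  where open ≤-Reasoning

<-2^length-bin : ∀ n → n < 2 ^ length (bin n)
<-2^length-bin n = subst (λ L → n < 2 ^ L) (sym (length-reverse (bitsLSB n n))) (<-2^length-bitsLSB n n ≤-refl)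

length-runs : ∀ {k} n gs → bin n ≡ word gs → s n ≡ suc k → length gs ≡ k
length-runs n gs bin≡ sn = suc-injective (trans (sym (sumBits-word gs)) (trans (cong sumBits (sym bin≡)) sn))

decomposition : ∀ k′ {T U M} n gs → 2 * (suc k′ * suc T) + suc k′ * suc k′ < U → T ≤ M →
  2 ^ (suc k′ * suc M) ≤ n → bin n ≡ word gs → length gs ≡ k′ → All (Outside T U) gs →
  Decomposition (suc k′) n
decomposition k′ {T} {U} {M} n gs U-large T≤M N≤n bin≡ length≡ out =
  length rest , blocks top rest , separators rest ,
  cut-found , s≤s (≤-trans length-rest (≤-reflexive length≡)) ,
  (λ i → let b , _ , x≡ = blocks-all (SmallBlock T K) top rest top-small rest-small i
         in subst (λ x → 1 ≤ x × Odd x) (sym x≡) (wordValue-odd b)) ,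
  trans bin≡ (trans word≡ (sym (layout-blocks top rest))) ,
  λ j i → ≤-<-trans (+-monoˡ-≤ (k * k) (*-monoʳ-≤ 2 (short i))) (<-≤-trans U-large (long j))
  where
  open Cut (cut T (Outside T U) gs out)
  k = suc k′
  K = length gs
  short : ∀ i → length (bin (blocks top rest i)) ≤ k * suc T
  short i with blocks-all (SmallBlock T K) top rest top-small rest-small i
  ... | b , small , x≡ rewrite x≡ | bin-wordValue b | length≡ = length-word-small b small
  long : ∀ j → U ≤ separators rest j
  long = separators-all (U ≤_) rest (All.map (λ {p} → separator-long {p}) rest-long)
    where
    separator-long : ∀ {p : ℕ × List ℕ} → T ≤ proj₁ p × Outside T U (proj₁ p) → U ≤ proj₁ p
    separator-long (T≤G , inj₁ G<T) = ⊥-elim (<⇒≱ G<T T≤G)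
    separator-long (_   , inj₂ U≤G) = U≤G
  cut-found : 1 ≤ length rest
  cut-found with rest | word≡
  ... | _ ∷ _ | _     = s≤s z≤n
  ... | []    | word≡ = ⊥-elim (<⇒≱ (<-2^length-bin n) (≤-trans (^-monoʳ-≤ 2 short-word) N≤n))
    where
    short-word : length (bin n) ≤ k * suc M
    short-word = begin
      length (bin n)            ≡⟨ cong length (trans bin≡ (trans word≡ (++-identityʳ (word top)))) ⟩
      length (word top)         ≤⟨ length-word-small top top-small ⟩
      suc K * suc T             ≡⟨ cong (λ K → suc K * suc T) length≡ ⟩
      k * suc T                 ≤⟨ *-monoʳ-≤ k (s≤s T≤M) ⟩
      k * suc M                 ∎
      where open ≤-Reasoning

threshold : ℕ → ℕ → ℕ
threshold k zero    = 0
threshold k (suc j) = suc (2 * (k * suc (threshold k j)) + k * k)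

threshold-step : ∀ k′ j → threshold (suc k′) j ≤ threshold (suc k′) (suc j)
threshold-step k′ j = begin
  t                                 ≤⟨ n≤1+n t ⟩
  suc t                             ≤⟨ m≤n*m (suc t) k ⟩
  k * suc t                         ≤⟨ m≤n*m (k * suc t) 2 ⟩
  2 * (k * suc t)                   ≤⟨ m≤m+n _ (k * k) ⟩
  2 * (k * suc t) + k * k           <⟨ n<1+n _ ⟩
  suc (2 * (k * suc t) + k * k)     ∎
  where
  open ≤-Reasoning
  k = suc k′
  t = threshold k j

threshold-mono : ∀ k′ {i j} → i ≤′ j → threshold (suc k′) i ≤ threshold (suc k′) j
threshold-mono k′ ≤′-refl      = ≤-refl
threshold-mono k′ (≤′-step i≤j) = ≤-trans (threshold-mono k′ i≤j) (threshold-step k′ _)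

lemma2 : (k : ℕ) → 1 ≤ k →
    Σ ℕ λ N → (n : ℕ) → N ≤ n → Odd n → s n ≡ k → s (n * n) ≡ k →
      Σ ℕ λ m → Σ (Fin (suc m) → ℕ) λ x → Σ (Fin m → ℕ) λ ℓ →
        (1 ≤ m) × (m < k) ×
        ((i : Fin (suc m)) → 1 ≤ x i × Odd (x i)) ×
        (bin n ≡ layout m x ℓ) ×
        ((j : Fin m) → (i : Fin (suc m)) → 2 * length (bin (x i)) + k * k < ℓ j)
lemma2 (suc k′) _ = 2 ^ (suc k′ * suc (t k′)) , decompose
  where
  t = threshold (suc k′)
  decompose : ∀ n → 2 ^ (suc k′ * suc (t k′)) ≤ n → Odd n → s n ≡ suc k′ → s (n * n) ≡ suc k′ → Decomposition (suc k′) n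
  decompose n N≤n odd sn _ with bin-odd n odd
  ... | gs , bin≡ with length-runs n gs bin≡ sn
  ... | length≡
    with avoided-interval t (threshold-step k′) k′ gs (≤-trans (countAtLeast≤length (t 0) gs) (≤-reflexive length≡))
  ... | j , j≤k′ , out =
    decomposition k′ n gs (n<1+n _) (threshold-mono k′ (≤⇒≤′ j≤k′)) N≤n bin≡ length≡ out
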